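{- For $n\ge 2$ and any integer $k$, \[\#\Big\{(\mathbf{d},\mathbf{r})\in\operatorname{Arith}(\mathcal{P}_n) : \sum_{j=1}^n d_j=k\Big\}=B(n-2,k-2n+2).\] In particular, there are no arithmetical structures on $\mathcal{P}_n$ with $\sum_{j=1}^n d_j=k$ unless $2n-2\le k\le 3n-4$.
   Context: $\mathcal{P}_n$ is the path graph with vertices $1,\dots,n$ and edges $\{i,i+1\}$, with adjacency matrix $A$. $\operatorname{Arith}(\mathcal{P}_n)$ is the set of arithmetical structures, i.e. pairs $(\mathbf{d},\mathbf{r})$ of positive integer vectors in $\mathbb{Z}^n$ with $\mathbf{r}$ primitive (gcd of entries $1$) and $(\operatorname{diag}(\mathbf{d})-A)\mathbf{r}=\mathbf{0}$. For integers $k\ge 0$ and $\ell$, the ballot number $B(k,\ell)$ is the number of lattice paths from $(0,0)$ to $(k,\ell)$ using unit east and north steps that never go above the line $y=x$; it is $0$ when $\ell<0$ or $\ell>k$. -}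

module Defs where

open import Data.Nat as ℕ using (ℕ; zero; suc; _<_)
open import Data.Nat.GCD using (gcd)
open import Data.Integer as ℤ using (ℤ; +_; -[1+_])
open import Data.Fin using (Fin; toℕ) renaming (zero to fzero; suc to fsuc)
open import Data.Vec using (Vec; lookup; foldr)
open import Data.Bool using (Bool; true; false; _∧_; if_then_else_)
open import Data.List as List using (List; []; _∷_; length; filter)
open import Data.Product using (_×_; Σ; _,_)
open import Data.Refinement using (Refinement)
open import Function.Bundles using (_↔_)
open import Relation.Nullary.Decidable using (⌊_⌋; yes; no)
open import Relation.Binary.PropositionalEquality using (_≡_)

sumFin : ∀ {n} → (Fin n → ℤ) → ℤ
sumFin {zero}  f = + 0
sumFin {suc n} f = f fzero ℤ.+ sumFin (λ i → f (fsuc i))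

-- adjacency matrix of the path graph P_n (vertices 1..n ↦ Fin n = 0..n-1),
-- edges {i, i+1}
pathAdj : ∀ {n} → Fin n → Fin n → ℤ
pathAdj i j with toℕ j ℕ.≟ suc (toℕ i) | toℕ i ℕ.≟ suc (toℕ j)
... | yes _ | _     = + 1
... | no _  | yes _ = + 1
... | no _  | no _  = + 0

diagM : ∀ {n} → Vec ℕ n → Fin n → Fin n → ℤ
diagM d i j with toℕ i ℕ.≟ toℕ j
... | yes _ = + lookup d i
... | no _  = + 0

lapM : ∀ {n} → Vec ℕ n → Fin n → Fin n → ℤ
lapM d i j = diagM d i j ℤ.- pathAdj i j

mulMV : ∀ {n} → (Fin n → Fin n → ℤ) → Vec ℕ n → Fin n → ℤ
mulMV M r i = sumFin (λ j → M i j ℤ.* + lookup r j)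

gcdVec : ∀ {n} → Vec ℕ n → ℕ
gcdVec = foldr _ gcd 0

IsArith : ∀ n → Vec ℕ n → Vec ℕ n → Set
IsArith n d r =
  ((i : Fin n) → 0 < lookup d i) ×
  ((i : Fin n) → 0 < lookup r i) ×
  (gcdVec r ≡ 1) ×
  ((i : Fin n) → mulMV (lapM d) r i ≡ + 0)

sumVec : ∀ {n} → Vec ℕ n → ℕ
sumVec = foldr _ ℕ._+_ 0

-- Arithmetical structures on P_n with sum of d-entries equal to k,
-- as a refinement type (proofs irrelevant, so elements are determined by (d , r)).
ArithSum : ℕ → ℤ → Set
ArithSum n k =
  Refinement (Vec ℕ n × Vec ℕ n) (λ { (d , r) → IsArith n d r × (+ sumVec d ≡ k) })

HasCard : Set → ℕ → Set
HasCard A m = Fin m ↔ A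

-- Ballot numbers: lattice paths (true = east step, false = north step)

allPaths : ℕ → List (List Bool)
allPaths zero    = [] ∷ []
allPaths (suc m) = List.map (true ∷_) (allPaths m) List.++ List.map (false ∷_) (allPaths m)

goodFrom : ℕ → ℕ → ℕ → ℕ → List Bool → Bool
goodFrom x y a b []            = ⌊ x ℕ.≟ a ⌋ ∧ ⌊ y ℕ.≟ b ⌋
goodFrom x y a b (true ∷ s)    = goodFrom (suc x) y a b s
goodFrom x y a b (false ∷ s)   = ⌊ suc y ℕ.≤? x ⌋ ∧ goodFrom x (suc y) a b s

countTrue : List (List Bool) → (List Bool → Bool) → ℕ
countTrue []       p = 0
countTrue (s ∷ ss) p = (if p s then 1 else 0) ℕ.+ countTrue ss p

-- B(k , ℓ): number of east/north lattice paths (0,0) → (k,ℓ) never above y = x;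
-- 0 when ℓ < 0 (no such paths).
ballot : ℕ → ℤ → ℕ
ballot k (+ l)      = countTrue (allPaths (k ℕ.+ l)) (goodFrom 0 0 k l)
ballot k -[1+ _ ]   = 0

-- Write an arithmetical structure on Pₙ as the recurrence dᵢ rᵢ = rᵢ₋₁ + rᵢ₊₁
-- (with r₀ = rₙ₊₁ = 0); primitivity then means r₁ = 1.  If no interior vertex
-- has d = 1, the sequence r₁, r₂, … is convex and hence constant, which leaves
-- only d = (1, 2, …, 2, 1), of d-sum 2n - 2.  Smoothing an interior vertex with d = 1
-- gives a structure on n - 1 vertices with d-sum smaller by 3, and subdividing an
-- edge undoes it.  Sorting structures on k + 2 vertices of d-sum 2k + 2 + ℓ by
-- their first interior vertex with d = 1 yields exactly the recursion of lattice
-- paths from (g , 0) to (k , ℓ) that stay below the diagonal, according to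
-- whether the first step goes east or north; so these structures are counted by
-- B(k , ℓ).  The upper bound on the d-sum is B(k , ℓ) = 0 for ℓ > k.

module Submission where

open import Defs
open import Data.Bool using (Bool; true; false; _∧_; if_then_else_)
open import Data.Bool.Properties using (∧-zeroʳ)
open import Data.Empty using (⊥-elim-irr)
open import Data.Fin using (Fin; toℕ) renaming (zero to fzero; suc to fsuc)
open import Data.Fin.Properties using (+↔⊎; ¬Fin0)
open import Data.Integer as ℤ using (ℤ; +_)
import Data.Integer.Properties as ℤₚ
import Data.Integer.Tactic.RingSolver as ℤ-Solver
open import Data.Irrelevant as Irrelevant using ([_])
open import Data.List as List using (List; []; _∷_; _++_)
open import Data.Nat
open import Data.Nat.Divisibility using (_∣_; ∣1⇒≡1; ∣m+n∣m⇒∣n; _∣0; ∣-refl; ∣m⇒∣m*n)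
open import Data.Nat.GCD using (gcd[m,n]∣m; gcd-greatest)
open import Data.Nat.Properties
open import Data.Nat.Tactic.RingSolver using (solve-∀)
open import Data.Product using (_×_; _,_; proj₁; proj₂; Σ-syntax)
open import Data.Refinement as Refinement using (Refinement; _,_; value-injective)
open import Data.Sum using (_⊎_; inj₁; inj₂)
open import Data.Sum.Function.Propositional using (_⊎-↔_)
open import Data.Unit using (⊤; tt)
open import Data.Vec using (Vec; []; _∷_; lookup; replicate; tail)
open import Data.Vec.Relation.Unary.All using (All; []; _∷_; all?)
open import Data.Vec.Relation.Unary.All.Properties using (lookup⁺; lookup⁻)
open import Function.Bundles using (_↔_; _⇔_; mk↔ₛ′; mk⇔; Inverse)
open import Function.Properties.Inverse using (↔-sym; ↔-trans)
open import Relation.Nullary using (¬_; Dec; yes; no; contradiction)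
open import Relation.Nullary.Decidable using (⌊_⌋; isYes≗does; does-⇔; dec-true; dec-false; recompute; _×-dec_)
open import Relation.Binary.PropositionalEquality
open import Algebra.Properties.CommutativeSemigroup +-commutativeSemigroup using (x∙yz≈y∙xz)

-- Lattice paths

countTrue-++ : ∀ xs ys (p : List Bool → Bool) → countTrue (xs ++ ys) p ≡ countTrue xs p + countTrue ys p
countTrue-++ []       ys p = refl
countTrue-++ (x ∷ xs) ys p =
  trans (cong (_+_ (if p x then 1 else 0)) (countTrue-++ xs ys p)) (sym (+-assoc (if p x then 1 else 0) _ _))

countTrue-map : ∀ (f : List Bool → List Bool) xs p → countTrue (List.map f xs) p ≡ countTrue xs (λ s → p (f s))
countTrue-map f []       p = refl
countTrue-map f (x ∷ xs) p = cong (_+_ _) (countTrue-map f xs p)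

countTrue-cong : ∀ xs {p q : List Bool → Bool} → (∀ s → p s ≡ q s) → countTrue xs p ≡ countTrue xs q
countTrue-cong []       p≗q = refl
countTrue-cong (x ∷ xs) p≗q = cong₂ (λ b n → (if b then 1 else 0) + n) (p≗q x) (countTrue-cong xs p≗q)

countTrue-const-false : ∀ xs → countTrue xs (λ _ → false) ≡ 0
countTrue-const-false []       = refl
countTrue-const-false (x ∷ xs) = countTrue-const-false xs

countTrue-false : ∀ xs {p : List Bool → Bool} → (∀ s → p s ≡ false) → countTrue xs p ≡ 0
countTrue-false xs p≗false = trans (countTrue-cong xs p≗false) (countTrue-const-false xs)

countTrue-∧ : ∀ xs c (q : List Bool → Bool) → countTrue xs (λ s → c ∧ q s) ≡ (if c then countTrue xs q else 0)
countTrue-∧ xs true  q = refl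
countTrue-∧ xs false q = countTrue-const-false xs

⌊⌋-⇔ : ∀ {A B : Set} → A ⇔ B → (a? : Dec A) (b? : Dec B) → ⌊ a? ⌋ ≡ ⌊ b? ⌋
⌊⌋-⇔ A⇔B a? b? = trans (isYes≗does a?) (trans (does-⇔ A⇔B a? b?) (sym (isYes≗does b?)))

⌊⌋-true : ∀ {A : Set} (a? : Dec A) → A → ⌊ a? ⌋ ≡ true
⌊⌋-true a? a = trans (isYes≗does a?) (dec-true a? a)

⌊⌋-false : ∀ {A : Set} (a? : Dec A) → ¬ A → ⌊ a? ⌋ ≡ false
⌊⌋-false a? ¬a = trans (isYes≗does a?) (dec-false a? ¬a)

pathCount : ℕ → ℕ → ℕ → ℕ → ℕ → ℕ
pathCount m x y a b = countTrue (allPaths m) (goodFrom x y a b)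

pathCount-suc : ∀ m x y a b →
  pathCount (suc m) x y a b ≡ pathCount m (suc x) y a b + (if ⌊ suc y ≤? x ⌋ then pathCount m x (suc y) a b else 0)
pathCount-suc m x y a b = begin
    countTrue (List.map (true ∷_) paths ++ List.map (false ∷_) paths) (goodFrom x y a b)
  ≡⟨ countTrue-++ (List.map (true ∷_) paths) _ (goodFrom x y a b) ⟩
    countTrue (List.map (true ∷_) paths) (goodFrom x y a b) + countTrue (List.map (false ∷_) paths) (goodFrom x y a b)
  ≡⟨ cong₂ _+_ (countTrue-map (true ∷_) paths _) (countTrue-map (false ∷_) paths _) ⟩
    pathCount m (suc x) y a b + countTrue paths (λ s → ⌊ suc y ≤? x ⌋ ∧ goodFrom x (suc y) a b s)
  ≡⟨ cong (_+_ (pathCount m (suc x) y a b)) (countTrue-∧ paths _ (goodFrom x (suc y) a b)) ⟩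
    pathCount m (suc x) y a b + (if ⌊ suc y ≤? x ⌋ then pathCount m x (suc y) a b else 0)
  ∎
  where
    open ≡-Reasoning
    paths = allPaths m

goodFrom-shift : ∀ x y a b s → goodFrom (suc x) (suc y) (suc a) (suc b) s ≡ goodFrom x y a b s
goodFrom-shift x y a b [] =
  cong₂ _∧_ (⌊⌋-⇔ (mk⇔ suc-injective (cong suc)) (suc x ≟ suc a) (x ≟ a))
            (⌊⌋-⇔ (mk⇔ suc-injective (cong suc)) (suc y ≟ suc b) (y ≟ b))
goodFrom-shift x y a b (true ∷ s)  = goodFrom-shift (suc x) y a b s
goodFrom-shift x y a b (false ∷ s) =
  cong₂ _∧_ (⌊⌋-⇔ (mk⇔ s≤s⁻¹ s≤s) (suc (suc y) ≤? suc x) (suc y ≤? x)) (goodFrom-shift x (suc y) a b s)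

pathCount-shift : ∀ m x y a b → pathCount m (suc x) (suc y) (suc a) (suc b) ≡ pathCount m x y a b
pathCount-shift m x y a b = countTrue-cong (allPaths m) (goodFrom-shift x y a b)

goodFrom-past-east : ∀ x y a b s → a < x → goodFrom x y a b s ≡ false
goodFrom-past-east x y a b []          a<x = cong (_∧ _) (⌊⌋-false (x ≟ a) (>⇒≢ a<x))
goodFrom-past-east x y a b (true ∷ s)  a<x = goodFrom-past-east (suc x) y a b s (m<n⇒m<1+n a<x)
goodFrom-past-east x y a b (false ∷ s) a<x =
  trans (cong (_ ∧_) (goodFrom-past-east x (suc y) a b s a<x)) (∧-zeroʳ _)

goodFrom-past-north : ∀ x y a b s → b < y → goodFrom x y a b s ≡ false
goodFrom-past-north x y a b []          b<y =
  trans (cong (_ ∧_) (⌊⌋-false (y ≟ b) (>⇒≢ b<y))) (∧-zeroʳ _)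
goodFrom-past-north x y a b (true ∷ s)  b<y = goodFrom-past-north (suc x) y a b s b<y
goodFrom-past-north x y a b (false ∷ s) b<y =
  trans (cong (_ ∧_) (goodFrom-past-north x (suc y) a b s (m<n⇒m<1+n b<y))) (∧-zeroʳ _)

goodFrom-above-diagonal : ∀ x y a b s → y ≤ x → a < b → goodFrom x y a b s ≡ false
goodFrom-above-diagonal x y a b [] y≤x a<b with x ≟ a | y ≟ b
... | yes refl | yes refl = contradiction (≤-<-trans y≤x a<b) (<-irrefl refl)
... | yes _    | no _     = refl
... | no _     | _        = refl
goodFrom-above-diagonal x y a b (true ∷ s)  y≤x a<b = goodFrom-above-diagonal (suc x) y a b s (m≤n⇒m≤1+n y≤x) a<b
goodFrom-above-diagonal x y a b (false ∷ s) y≤x a<b with suc y ≤? x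
... | yes y<x = goodFrom-above-diagonal x (suc y) a b s y<x a<b
... | no _    = refl

pathCount-straight : ∀ m x → pathCount m x 0 (m + x) 0 ≡ 1
pathCount-straight zero    x = cong (λ b → (if b ∧ true then 1 else 0) + 0) (⌊⌋-true (x ≟ x) refl)
pathCount-straight (suc m) x = begin
    pathCount (suc m) x 0 (suc m + x) 0
  ≡⟨ pathCount-suc m x 0 (suc m + x) 0 ⟩
    pathCount m (suc x) 0 (suc m + x) 0 + (if ⌊ 1 ≤? x ⌋ then pathCount m x 1 (suc m + x) 0 else 0)
  ≡⟨ cong₂ _+_ (cong (λ t → pathCount m (suc x) 0 t 0) (sym (+-suc m x)))
               (cong (λ t → if ⌊ 1 ≤? x ⌋ then t else 0) north-blocked) ⟩
    pathCount m (suc x) 0 (m + suc x) 0 + (if ⌊ 1 ≤? x ⌋ then 0 else 0)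
  ≡⟨ cong₂ _+_ (pathCount-straight m (suc x)) (if-same ⌊ 1 ≤? x ⌋) ⟩
    1
  ∎
  where
    open ≡-Reasoning
    north-blocked : pathCount m x 1 (suc m + x) 0 ≡ 0
    north-blocked = countTrue-false (allPaths m) (λ s → goodFrom-past-north x 1 _ 0 s (s≤s z≤n))
    if-same : ∀ c → (if c then 0 else 0) ≡ 0
    if-same true  = refl
    if-same false = refl

ballotFrom : ℕ → ℕ → ℕ → ℕ
ballotFrom g k ℓ = pathCount ((k ∸ g) + ℓ) g 0 k ℓ

-- A north step from (1 + h , 0) lands on (1 + h , 1), which the diagonal
-- translation by (1 , 1) sends back to (h , 0).
ballotFrom-split : ∀ k ℓ h → h < k →
  ballotFrom (suc h) (suc k) (suc ℓ) ≡ ballotFrom (suc (suc h)) (suc k) (suc ℓ) + ballotFrom h k ℓ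
ballotFrom-split k ℓ h h<k = begin
    pathCount (suc k ∸ suc h + suc ℓ) (suc h) 0 (suc k) (suc ℓ)
  ≡⟨ cong (λ t → pathCount (t + suc ℓ) (suc h) 0 (suc k) (suc ℓ)) (+-∸-assoc 1 h<k) ⟩
    pathCount (suc (m + suc ℓ)) (suc h) 0 (suc k) (suc ℓ)
  ≡⟨ pathCount-suc (m + suc ℓ) (suc h) 0 (suc k) (suc ℓ) ⟩
    pathCount (m + suc ℓ) (suc (suc h)) 0 (suc k) (suc ℓ) + pathCount (m + suc ℓ) (suc h) 1 (suc k) (suc ℓ)
  ≡⟨ cong (_+_ (ballotFrom (suc (suc h)) (suc k) (suc ℓ))) (pathCount-shift (m + suc ℓ) h 0 k ℓ) ⟩
    ballotFrom (suc (suc h)) (suc k) (suc ℓ) + pathCount (m + suc ℓ) h 0 k ℓ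
  ≡⟨ cong (λ t → ballotFrom (suc (suc h)) (suc k) (suc ℓ) + pathCount t h 0 k ℓ)
          (trans (+-suc m ℓ) (cong (_+ ℓ) (sym (+-∸-assoc 1 h<k)))) ⟩
    ballotFrom (suc (suc h)) (suc k) (suc ℓ) + ballotFrom h k ℓ
  ∎
  where
    open ≡-Reasoning
    m = k ∸ suc h

ballotFrom-corner : ∀ k ℓ → ballotFrom (suc k) (suc k) (suc ℓ) ≡ ballotFrom k k ℓ
ballotFrom-corner k ℓ = begin
    pathCount (k ∸ k + suc ℓ) (suc k) 0 (suc k) (suc ℓ)
  ≡⟨ cong (λ t → pathCount (t + suc ℓ) (suc k) 0 (suc k) (suc ℓ)) (n∸n≡0 k) ⟩
    pathCount (suc ℓ) (suc k) 0 (suc k) (suc ℓ)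
  ≡⟨ pathCount-suc ℓ (suc k) 0 (suc k) (suc ℓ) ⟩
    pathCount ℓ (suc (suc k)) 0 (suc k) (suc ℓ) + pathCount ℓ (suc k) 1 (suc k) (suc ℓ)
  ≡⟨ cong₂ _+_ east-blocked (pathCount-shift ℓ k 0 k ℓ) ⟩
    pathCount ℓ k 0 k ℓ
  ≡⟨ cong (λ t → pathCount (t + ℓ) k 0 k ℓ) (sym (n∸n≡0 k)) ⟩
    ballotFrom k k ℓ
  ∎
  where
    open ≡-Reasoning
    east-blocked : pathCount ℓ (suc (suc k)) 0 (suc k) (suc ℓ) ≡ 0
    east-blocked = countTrue-false (allPaths ℓ) (λ s → goodFrom-past-east _ 0 (suc k) (suc ℓ) s (n<1+n (suc k)))

ballotFrom-origin : ∀ k ℓ → ballotFrom 0 (suc k) (suc ℓ) ≡ ballotFrom 1 (suc k) (suc ℓ)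
ballotFrom-origin k ℓ = trans (pathCount-suc (k + suc ℓ) 0 0 (suc k) (suc ℓ)) (+-identityʳ _)

ballotFrom-zero-width : ∀ ℓ → ballotFrom 0 0 (suc ℓ) ≡ 0
ballotFrom-zero-width ℓ =
  trans (pathCount-suc ℓ 0 0 0 (suc ℓ))
        (trans (+-identityʳ _) (countTrue-false (allPaths ℓ) (λ s → goodFrom-past-east 1 0 0 (suc ℓ) s (s≤s z≤n))))

ballotFrom-flat : ∀ k g → g ≤ k → ballotFrom g k 0 ≡ 1
ballotFrom-flat k g g≤k = begin
    pathCount (k ∸ g + 0) g 0 k 0
  ≡⟨ cong (λ t → pathCount t g 0 k 0) (+-identityʳ (k ∸ g)) ⟩
    pathCount (k ∸ g) g 0 k 0
  ≡⟨ cong (λ t → pathCount (k ∸ g) g 0 t 0) (sym (m∸n+n≡m g≤k)) ⟩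
    pathCount (k ∸ g) g 0 (k ∸ g + g) 0
  ≡⟨ pathCount-straight (k ∸ g) g ⟩
    1
  ∎
  where open ≡-Reasoning

ballot-above-diagonal : ∀ k ℓ → k < ℓ → ballot k (ℤ.+ ℓ) ≡ 0
ballot-above-diagonal k ℓ k<ℓ =
  countTrue-false (allPaths (k + ℓ)) (λ s → goodFrom-above-diagonal 0 0 k ℓ s z≤n k<ℓ)

-- Arithmetical structures on paths as recurrences

-- vₕ, read as 0 beyond the end of v.
entry : ∀ {n} → ℕ → Vec ℕ n → ℕ
entry _       []      = 0
entry zero    (x ∷ _) = x
entry (suc h) (_ ∷ v) = entry h v

-- dᵢ rᵢ ≡ rᵢ₋₁ + rᵢ₊₁ along the vectors, where p plays the role of r₋₁ and
-- the entry after the last one is 0.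
Recurrence : ∀ {n} → ℕ → Vec ℕ n → Vec ℕ n → Set
Recurrence p []       []       = ⊤
Recurrence p (d ∷ ds) (r ∷ rs) = d * r ≡ p + entry 0 rs × Recurrence r ds rs

Positive : ∀ {n} → Vec ℕ n → Set
Positive = All (0 <_)

-- Primitivity of r is replaced by the equivalent condition entry 0 r ≡ 1.
IsStructure : ∀ {n} → Vec ℕ n → Vec ℕ n → Set
IsStructure d r = Recurrence 0 d r × Positive r × entry 0 r ≡ 1

recurrence? : ∀ {n} p (d r : Vec ℕ n) → Dec (Recurrence p d r)
recurrence? p []       []       = yes tt
recurrence? p (a ∷ ds) (x ∷ rs) = (a * x ≟ p + entry 0 rs) ×-dec recurrence? x ds rs

isStructure? : ∀ {n} (d r : Vec ℕ n) → Dec (IsStructure d r)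
isStructure? d r = recurrence? 0 d r ×-dec all? (0 <?_) r ×-dec (entry 0 r ≟ 1)

positive-factor : ∀ a {x s} → a * x ≡ s → 0 < s → 0 < a
positive-factor zero    refl ()
positive-factor (suc a) _    _ = s≤s z≤n

recurrence-positive : ∀ {n p} (d r : Vec ℕ n) → Recurrence p d r → Positive r → 0 < p → Positive d
recurrence-positive []       []       _          _             _   = []
recurrence-positive (a ∷ ds) (x ∷ rs) (e , rec) (x>0 ∷ rs>0) p>0 =
  positive-factor a e (≤-trans p>0 (m≤m+n _ _)) ∷ recurrence-positive ds rs rec rs>0 x>0

structure-positive : ∀ {n} (d r : Vec ℕ (suc (suc n))) → IsStructure d r → Positive d
structure-positive (a ∷ ds) (x ∷ y ∷ rs) ((e , rec) , x>0 ∷ rs>0@(y>0 ∷ _) , _) =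
  positive-factor a e y>0 ∷ recurrence-positive ds (y ∷ rs) rec rs>0 x>0

positive-replicate : ∀ n {x} → 0 < x → Positive (replicate n x)
positive-replicate zero    x>0 = []
positive-replicate (suc n) x>0 = x>0 ∷ positive-replicate n x>0

NoOneBefore : ∀ {n} → ℕ → Vec ℕ n → Set
NoOneBefore zero    _        = ⊤
NoOneBefore (suc c) []       = ⊤
NoOneBefore (suc c) (x ∷ xs) = x ≢ 1 × NoOneBefore c xs

noOneBefore-snoc : ∀ {n} h (v : Vec ℕ n) → NoOneBefore h v → entry h v ≢ 1 → NoOneBefore (suc h) v
noOneBefore-snoc h       []      _           _    = tt
noOneBefore-snoc zero    (x ∷ v) _           x≢1  = x≢1 , tt
noOneBefore-snoc (suc h) (x ∷ v) (x≢1 , no1) vₕ≢1 = x≢1 , noOneBefore-snoc h v no1 vₕ≢1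

noOneBefore-init : ∀ {n} h (v : Vec ℕ n) → NoOneBefore (suc h) v → NoOneBefore h v
noOneBefore-init zero    v       _           = tt
noOneBefore-init (suc h) []      _           = tt
noOneBefore-init (suc h) (x ∷ v) (x≢1 , no1) = x≢1 , noOneBefore-init h v no1

noOneBefore-last : ∀ {n} h (v : Vec ℕ n) → NoOneBefore (suc h) v → entry h v ≢ 1
noOneBefore-last h       []      _         ()
noOneBefore-last zero    (x ∷ v) (x≢1 , _) = x≢1
noOneBefore-last (suc h) (x ∷ v) (_ , no1) = noOneBefore-last h v no1

twosThenOne : ∀ k → Vec ℕ (suc k)
twosThenOne zero    = 1 ∷ []
twosThenOne (suc k) = 2 ∷ twosThenOne k

minimalD : ∀ k → Vec ℕ (suc (suc k))
minimalD k = 1 ∷ twosThenOne k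

recurrence-twosThenOne : ∀ k → Recurrence 1 (twosThenOne k) (replicate (suc k) 1)
recurrence-twosThenOne zero    = refl , tt
recurrence-twosThenOne (suc k) = refl , recurrence-twosThenOne k

minimal-structure : ∀ k → IsStructure (minimalD k) (replicate (suc (suc k)) 1)
minimal-structure k = (refl , recurrence-twosThenOne k) , positive-replicate (suc (suc k)) (s≤s z≤n) , refl

noOneBefore-twosThenOne : ∀ c k → c ≤ k → NoOneBefore c (twosThenOne k)
noOneBefore-twosThenOne zero    k       _         = tt
noOneBefore-twosThenOne (suc c) (suc k) (s≤s c≤k) = (λ ()) , noOneBefore-twosThenOne c k c≤k

convex-step : ∀ a x p y → (2 + a) * x ≡ p + y → p ≤ x → x ≤ y
convex-step a x p y e p≤x = +-cancelˡ-≤ p x y (begin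
    p + x            ≤⟨ +-monoˡ-≤ x p≤x ⟩
    x + x            ≤⟨ +-monoʳ-≤ x (m≤m+n x (a * x)) ⟩
    x + (x + a * x)  ≡⟨ e ⟩
    p + y            ∎)
  where open ≤-Reasoning

flat-step : ∀ a x p → (2 + a) * x ≡ p + x → p ≤ x → 0 < x → a ≡ 0 × p ≡ x
flat-step a x p e p≤x x>0 = a≡0 , trans (sym x+ax≡p) (trans (cong (_+_ x) ax≡0) (+-identityʳ x))
  where
    x+ax≡p : x + a * x ≡ p
    x+ax≡p = +-cancelˡ-≡ x _ _ (trans e (+-comm p x))
    ax≡0 : a * x ≡ 0
    ax≡0 = n≤0⇒n≡0 (+-cancelˡ-≤ x (a * x) 0
             (subst (x + a * x ≤_) (sym (+-identityʳ x)) (≤-trans (≤-reflexive x+ax≡p) p≤x)))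
    a≡0 : a ≡ 0
    a≡0 = m*n≡0⇒m≡0 a x {{>-nonZero x>0}} ax≡0

-- With every dᵢ ≥ 2 the sequence r is convex, hence nondecreasing from p ≤ r₀;
-- the last equation dₘ rₘ = rₘ₋₁ then forces it to be constant.
recurrence-without-ones : ∀ m p (ds rs : Vec ℕ (suc m)) → Recurrence p ds rs → Positive rs →
  NoOneBefore m ds → 0 < p → p ≤ entry 0 rs → ds ≡ twosThenOne m × rs ≡ replicate (suc m) p
recurrence-without-ones zero p (zero ∷ []) (x ∷ []) (e , _) _ _ p>0 _ =
  contradiction (trans e (+-identityʳ p)) (<⇒≢ p>0)
recurrence-without-ones zero p (1 ∷ []) (x ∷ []) (e , _) _ _ _ _ =
  refl , cong (_∷ []) (trans (sym (+-identityʳ x)) (trans e (+-identityʳ p)))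
recurrence-without-ones zero p (suc (suc a) ∷ []) (x ∷ []) (e , _) (x>0 ∷ []) _ _ p≤x =
  contradiction (convex-step a x p 0 e p≤x) (<⇒≱ x>0)
recurrence-without-ones (suc m) p (zero ∷ ds) (x ∷ rs) (e , _) _ _ p>0 _ =
  contradiction e (<⇒≢ (≤-trans p>0 (m≤m+n p _)))
recurrence-without-ones (suc m) p (1 ∷ ds) (x ∷ rs) _ _ (1≢1 , _) _ _ = contradiction refl 1≢1
recurrence-without-ones (suc m) p (suc (suc a) ∷ ds) (x ∷ rs) (e , rec) (x>0 ∷ rs>0) (_ , no1) p>0 p≤x
  with recurrence-without-ones m x ds rs rec rs>0 no1 x>0 (convex-step a x p (entry 0 rs) e p≤x)
... | refl , refl with flat-step a x p e p≤x x>0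
...   | refl , refl = refl , refl

structure-without-ones : ∀ k (d r : Vec ℕ (suc (suc k))) → IsStructure d r → NoOneBefore k (tail d) →
  d ≡ minimalD k × r ≡ replicate (suc (suc k)) 1
structure-without-ones k (a ∷ ds) (x ∷ y ∷ rs) ((e , rec) , _ ∷ rs>0@(y>0 ∷ _) , refl) no1
  with recurrence-without-ones k 1 ds (y ∷ rs) rec rs>0 no1 (s≤s z≤n) y>0
... | refl , refl = cong (_∷ twosThenOne k) (trans (sym (*-identityʳ a)) e) , refl

-- Subdivision and smoothing

incrementHead : ∀ {n} → Vec ℕ n → Vec ℕ n
incrementHead []      = []
incrementHead (b ∷ v) = suc b ∷ v

decrementHead : ∀ {n} → Vec ℕ n → Vec ℕ n
decrementHead []      = []
decrementHead (b ∷ v) = pred b ∷ v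

-- Subdividing the edge between vertices h and h + 1 inserts a vertex with
-- d = 1 and r = rₕ + rₕ₊₁, and raises the d of both neighbours by one;
-- smoothing at h removes the vertex h + 1 again.  The clauses on vectors
-- too short for the position are junk.
subdivideD : ∀ {n} → ℕ → Vec ℕ n → Vec ℕ (suc n)
subdivideD _       []      = 0 ∷ []
subdivideD zero    (a ∷ v) = suc a ∷ 1 ∷ incrementHead v
subdivideD (suc h) (a ∷ v) = a ∷ subdivideD h v

subdivideR : ∀ {n} → ℕ → Vec ℕ n → Vec ℕ (suc n)
subdivideR _       []      = 0 ∷ []
subdivideR zero    (x ∷ v) = x ∷ (x + entry 0 v) ∷ v
subdivideR (suc h) (x ∷ v) = x ∷ subdivideR h v

smoothD : ∀ {n} → ℕ → Vec ℕ (suc n) → Vec ℕ n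
smoothD {zero}  _       _           = []
smoothD {suc n} zero    (a ∷ _ ∷ v) = pred a ∷ decrementHead v
smoothD {suc n} (suc h) (a ∷ v)     = a ∷ smoothD h v

smoothR : ∀ {n} → ℕ → Vec ℕ (suc n) → Vec ℕ n
smoothR {zero}  _       _           = []
smoothR {suc n} zero    (x ∷ _ ∷ v) = x ∷ v
smoothR {suc n} (suc h) (x ∷ v)     = x ∷ smoothR h v

entry₀-subdivideR : ∀ {n} h (r : Vec ℕ (suc n)) → entry 0 (subdivideR h r) ≡ entry 0 r
entry₀-subdivideR zero    (x ∷ r) = refl
entry₀-subdivideR (suc h) (x ∷ r) = refl

entry₀-smoothR : ∀ {n} h (r : Vec ℕ (suc (suc n))) → entry 0 (smoothR h r) ≡ entry 0 r
entry₀-smoothR zero    (x ∷ _ ∷ v) = refl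
entry₀-smoothR (suc h) (x ∷ v)     = refl

recurrence-subdivide : ∀ {k} h p (d r : Vec ℕ (suc (suc k))) → h ≤ k → Recurrence p d r →
  Recurrence p (subdivideD h d) (subdivideR h r)
recurrence-subdivide zero p (a ∷ b ∷ v) (x ∷ y ∷ w) _ (e₁ , e₂ , rec) =
  trans (cong (_+_ x) e₁) (shuffle₁ x p y) ,
  +-identityʳ (x + y) ,
  trans (cong (_+_ y) e₂) (shuffle₂ y x (entry 0 w)) ,
  rec
  where
    shuffle₁ : ∀ x p y → x + (p + y) ≡ p + (x + y)
    shuffle₁ = solve-∀
    shuffle₂ : ∀ y x z → y + (x + z) ≡ x + y + z
    shuffle₂ = solve-∀
recurrence-subdivide {suc k} (suc h) p (a ∷ d) (x ∷ y ∷ r) (s≤s h≤k) (e , rec) =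
  trans e (cong (_+_ p) (sym (entry₀-subdivideR h (y ∷ r)))) , recurrence-subdivide h x d (y ∷ r) h≤k rec

recurrence-smooth : ∀ {k} h p (d r : Vec ℕ (suc (suc (suc k)))) → h ≤ k → Recurrence p d r → Positive d →
  entry (suc h) d ≡ 1 → Recurrence p (smoothD h d) (smoothR h r)
recurrence-smooth zero p (suc a ∷ c ∷ suc b ∷ v) (x ∷ z ∷ y ∷ w) _ (e₁ , e₂ , e₃ , rec) _ refl =
  +-cancelˡ-≡ x _ _ (trans (trans e₁ (cong (_+_ p) z≡x+y)) (shuffle₁ x p y)) ,
  +-cancelˡ-≡ y _ _ (trans (trans e₃ (cong (_+ entry 0 w) z≡x+y)) (shuffle₂ x y (entry 0 w))) , rec
  where
    z≡x+y : z ≡ x + y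
    z≡x+y = trans (sym (+-identityʳ z)) e₂
    shuffle₁ : ∀ x p y → p + (x + y) ≡ x + (p + y)
    shuffle₁ = solve-∀
    shuffle₂ : ∀ x y z → x + y + z ≡ y + (x + z)
    shuffle₂ = solve-∀
recurrence-smooth zero _ (zero ∷ _)           _ _ _ (() ∷ _)         _
recurrence-smooth zero _ (_ ∷ _ ∷ zero ∷ _)   _ _ _ (_ ∷ _ ∷ () ∷ _) _
recurrence-smooth {suc k} (suc h) p (a ∷ d) (x ∷ y ∷ r) (s≤s h≤k) (e , rec) (_ ∷ d>0) d₁≡1 =
  trans e (cong (_+_ p) (sym (entry₀-smoothR h (y ∷ r)))) , recurrence-smooth h x d (y ∷ r) h≤k rec d>0 d₁≡1

positive-subdivideR : ∀ {k} h (r : Vec ℕ (suc (suc k))) → h ≤ k → Positive r → Positive (subdivideR h r)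
positive-subdivideR zero (x ∷ y ∷ w) _ r>0@(x>0 ∷ _) = x>0 ∷ ≤-trans x>0 (m≤m+n x y) ∷ All.tail r>0
  where import Data.Vec.Relation.Unary.All as All
positive-subdivideR {suc k} (suc h) (x ∷ r) (s≤s h≤k) (x>0 ∷ r>0) = x>0 ∷ positive-subdivideR h r h≤k r>0

positive-smoothR : ∀ {n} h (r : Vec ℕ (suc n)) → Positive r → Positive (smoothR h r)
positive-smoothR {zero}  _       _           _                  = []
positive-smoothR {suc n} zero    (x ∷ _ ∷ v) (x>0 ∷ _ ∷ v>0)    = x>0 ∷ v>0
positive-smoothR {suc n} (suc h) (x ∷ v)     (x>0 ∷ v>0)        = x>0 ∷ positive-smoothR h v v>0

structure-subdivide : ∀ {k} h (d r : Vec ℕ (suc (suc k))) → h ≤ k → IsStructure d r →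
  IsStructure (subdivideD h d) (subdivideR h r)
structure-subdivide h d r h≤k (rec , r>0 , r₀≡1) =
  recurrence-subdivide h 0 d r h≤k rec , positive-subdivideR h r h≤k r>0 , trans (entry₀-subdivideR h r) r₀≡1

structure-smooth : ∀ {k} h (d r : Vec ℕ (suc (suc (suc k)))) → h ≤ k → IsStructure d r →
  entry (suc h) d ≡ 1 → IsStructure (smoothD h d) (smoothR h r)
structure-smooth h d r h≤k s@(rec , r>0 , r₀≡1) d₁≡1 =
  recurrence-smooth h 0 d r h≤k rec (structure-positive d r s) d₁≡1 ,
  positive-smoothR h r r>0 , trans (entry₀-smoothR h r) r₀≡1

sum-subdivideD : ∀ {k} h (d : Vec ℕ (suc (suc k))) → h ≤ k → sumVec (subdivideD h d) ≡ 3 + sumVec d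
sum-subdivideD zero (a ∷ b ∷ v) _ = shuffle a b (sumVec v)
  where
    shuffle : ∀ a b s → suc a + (1 + (suc b + s)) ≡ 3 + (a + (b + s))
    shuffle = solve-∀
sum-subdivideD {suc k} (suc h) (a ∷ d) (s≤s h≤k) =
  trans (cong (_+_ a) (sum-subdivideD h d h≤k)) (x∙yz≈y∙xz a 3 (sumVec d))

sum-smoothD : ∀ {k} h (d : Vec ℕ (suc (suc (suc k)))) → h ≤ k → Positive d → entry (suc h) d ≡ 1 →
  3 + sumVec (smoothD h d) ≡ sumVec d
sum-smoothD zero (suc a ∷ _ ∷ suc b ∷ v) _ _ refl = shuffle a b (sumVec v)
  where
    shuffle : ∀ a b s → 3 + (a + (b + s)) ≡ suc a + (1 + (suc b + s))
    shuffle = solve-∀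
sum-smoothD zero (zero ∷ _)         _ (() ∷ _)         _
sum-smoothD zero (_ ∷ _ ∷ zero ∷ _) _ (_ ∷ _ ∷ () ∷ _) _
sum-smoothD {suc k} (suc h) (a ∷ d) (s≤s h≤k) (_ ∷ d>0) d₁≡1 =
  trans (sym (x∙yz≈y∙xz a 3 (sumVec (smoothD h d)))) (cong (_+_ a) (sum-smoothD h d h≤k d>0 d₁≡1))

entry-subdivideD : ∀ {k} h (d : Vec ℕ (suc (suc k))) → h ≤ k → entry (suc h) (subdivideD h d) ≡ 1
entry-subdivideD zero    (a ∷ b ∷ v) _         = refl
entry-subdivideD {suc k} (suc h) (a ∷ d) (s≤s h≤k) = entry-subdivideD h d h≤k

noOneBefore-subdivideD : ∀ {n} c (v : Vec ℕ n) → NoOneBefore c v → Positive v → NoOneBefore (suc c) (subdivideD c v)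
noOneBefore-subdivideD zero    []      _            _           = (λ ()) , tt
noOneBefore-subdivideD zero    (b ∷ v) _            (b>0 ∷ _)   = (λ b+1≡1 → <⇒≢ b>0 (sym (suc-injective b+1≡1))) , tt
noOneBefore-subdivideD (suc c) []      _            _           = (λ ()) , tt
noOneBefore-subdivideD (suc c) (b ∷ v) (b≢1 , no1) (_ ∷ v>0)   = b≢1 , noOneBefore-subdivideD c v no1 v>0

noOneBefore-smoothD : ∀ {n} c (v : Vec ℕ (suc n)) → NoOneBefore (suc c) v → NoOneBefore c (smoothD c v)
noOneBefore-smoothD zero            v       _           = tt
noOneBefore-smoothD {zero}  (suc c) v       _           = tt
noOneBefore-smoothD {suc n} (suc c) (b ∷ v) (b≢1 , no1) = b≢1 , noOneBefore-smoothD c v no1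

smooth-subdivideD : ∀ {k} h (d : Vec ℕ (suc (suc k))) → h ≤ k → smoothD h (subdivideD h d) ≡ d
smooth-subdivideD zero    (a ∷ b ∷ v) _         = refl
smooth-subdivideD {suc k} (suc h) (a ∷ d) (s≤s h≤k) = cong (a ∷_) (smooth-subdivideD h d h≤k)

smooth-subdivideR : ∀ {k} h (r : Vec ℕ (suc (suc k))) → h ≤ k → smoothR h (subdivideR h r) ≡ r
smooth-subdivideR zero    (x ∷ y ∷ v) _         = refl
smooth-subdivideR {suc k} (suc h) (x ∷ r) (s≤s h≤k) = cong (x ∷_) (smooth-subdivideR h r h≤k)

subdivide-smoothD : ∀ {k} h (d : Vec ℕ (suc (suc (suc k)))) → h ≤ k → Positive d → entry (suc h) d ≡ 1 →
  subdivideD h (smoothD h d) ≡ d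
subdivide-smoothD zero (suc a ∷ _ ∷ suc b ∷ v) _ _                refl = refl
subdivide-smoothD zero (zero ∷ _)              _ (() ∷ _)         _
subdivide-smoothD zero (_ ∷ _ ∷ zero ∷ _)      _ (_ ∷ _ ∷ () ∷ _) _
subdivide-smoothD {suc k} (suc h) (a ∷ d) (s≤s h≤k) (_ ∷ d>0) d₁≡1 =
  cong (a ∷_) (subdivide-smoothD h d h≤k d>0 d₁≡1)

subdivide-smoothR : ∀ {k} h p (d r : Vec ℕ (suc (suc (suc k)))) → h ≤ k → Recurrence p d r → entry (suc h) d ≡ 1 →
  subdivideR h (smoothR h r) ≡ r
subdivide-smoothR zero p (a ∷ _ ∷ b ∷ v) (x ∷ z ∷ y ∷ w) _ (_ , e₂ , _) refl =
  cong (λ t → x ∷ t ∷ y ∷ w) (sym (trans (sym (+-identityʳ z)) e₂))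
subdivide-smoothR {suc k} (suc h) p (a ∷ d) (x ∷ y ∷ r) (s≤s h≤k) (_ , rec) d₁≡1 =
  cong (x ∷_) (subdivide-smoothR h x d (y ∷ r) h≤k rec d₁≡1)

-- 2 (k + 2) - 2 + ℓ, for a path with k + 2 vertices.
targetSum : ℕ → ℕ → ℕ
targetSum k ℓ = suc (suc (k + k + ℓ))

targetSum-sucˡ : ∀ k ℓ → targetSum (suc k) ℓ ≡ 2 + targetSum k ℓ
targetSum-sucˡ k ℓ = cong (_+_ 2) (shuffle k ℓ)
  where
    shuffle : ∀ k ℓ → suc k + suc k + ℓ ≡ 2 + (k + k + ℓ)
    shuffle = solve-∀

targetSum-suc : ∀ k ℓ → targetSum (suc k) (suc ℓ) ≡ 3 + targetSum k ℓ
targetSum-suc k ℓ = trans (targetSum-sucˡ k (suc ℓ)) (cong (_+_ 2) (cong suc (cong suc (+-suc (k + k) ℓ))))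

targetSum-excess : ∀ m ℓ → targetSum m 0 + ℓ ≡ targetSum m ℓ
targetSum-excess m ℓ = cong (λ t → suc (suc (t + ℓ))) (+-identityʳ (m + m))

targetSum-monoʳ : ∀ m {ℓ ℓ′} → ℓ ≤ ℓ′ → targetSum m ℓ ≤ targetSum m ℓ′
targetSum-monoʳ m ℓ≤ℓ′ = s≤s (s≤s (+-monoʳ-≤ (m + m) ℓ≤ℓ′))

sum-minimalD : ∀ k → sumVec (minimalD k) ≡ targetSum k 0
sum-minimalD zero    = refl
sum-minimalD (suc k) = trans (cong (_+_ 2) (sum-minimalD k)) (sym (targetSum-sucˡ k 0))

firstOne : ∀ {n} c (v : Vec ℕ n) → NoOneBefore c v ⊎ Σ[ h ∈ ℕ ] h < c × NoOneBefore h v × entry h v ≡ 1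
firstOne zero    v       = inj₁ tt
firstOne (suc c) []      = inj₁ tt
firstOne (suc c) (x ∷ v) with x ≟ 1
... | yes x≡1 = inj₂ (0 , s≤s z≤n , tt , x≡1)
... | no  x≢1 with firstOne c v
...   | inj₁ no1                     = inj₁ (x≢1 , no1)
...   | inj₂ (h , h<c , no1 , vₕ≡1) = inj₂ (suc h , s≤s h<c , (x≢1 , no1) , vₕ≡1)

structure-without-ones-sum : ∀ k (d r : Vec ℕ (suc (suc k))) → IsStructure d r → NoOneBefore k (tail d) →
  sumVec d ≡ targetSum k 0
structure-without-ones-sum k d r s no1 with structure-without-ones k d r s no1
... | refl , refl = sum-minimalD k

structure-sum-≥ : ∀ k (d r : Vec ℕ (suc (suc k))) → IsStructure d r → targetSum k 0 ≤ sumVec d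
structure-with-one-sum-≥ : ∀ k h (d r : Vec ℕ (suc (suc (suc k)))) → h ≤ k → IsStructure d r →
  entry (suc h) d ≡ 1 → 3 + targetSum k 0 ≤ sumVec d

structure-sum-≥ k d r s with firstOne k (tail d)
... | inj₁ no1 = ≤-reflexive (sym (structure-without-ones-sum k d r s no1))
structure-sum-≥ zero    d       r s | inj₂ (_ , () , _)
structure-sum-≥ (suc k) (a ∷ d) r s | inj₂ (h , s≤s h≤k , _ , d₁≡1) = begin
  targetSum (suc k) 0  ≡⟨ targetSum-sucˡ k 0 ⟩
  2 + targetSum k 0    ≤⟨ n≤1+n _ ⟩
  3 + targetSum k 0    ≤⟨ structure-with-one-sum-≥ k h (a ∷ d) r h≤k s d₁≡1 ⟩
  sumVec (a ∷ d)       ∎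
  where open ≤-Reasoning

structure-with-one-sum-≥ k h d r h≤k s d₁≡1 = begin
  3 + targetSum k 0          ≤⟨ +-monoʳ-≤ 3 (structure-sum-≥ k _ _ (structure-smooth h d r h≤k s d₁≡1)) ⟩
  3 + sumVec (smoothD h d)   ≡⟨ sum-smoothD h d h≤k (structure-positive d r s) d₁≡1 ⟩
  sumVec d                   ∎
  where open ≤-Reasoning

structure-minimal-sum : ∀ k (d r : Vec ℕ (suc (suc k))) → IsStructure d r → sumVec d ≡ targetSum k 0 →
  d ≡ minimalD k × r ≡ replicate (suc (suc k)) 1
structure-minimal-sum k d r s sum≡ with firstOne k (tail d)
... | inj₁ no1 = structure-without-ones k d r s no1
structure-minimal-sum zero    d       r s sum≡ | inj₂ (_ , () , _)
structure-minimal-sum (suc k) (a ∷ d) r s sum≡ | inj₂ (h , s≤s h≤k , _ , d₁≡1) =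
  contradiction (subst (3 + targetSum k 0 ≤_) (trans sum≡ (targetSum-sucˡ k 0))
                       (structure-with-one-sum-≥ k h (a ∷ d) r h≤k s d₁≡1))
                (n≮n (2 + targetSum k 0))

HasCard-⊎ : ∀ {A B : Set} {m n} → HasCard A m → HasCard B n → HasCard (A ⊎ B) (m + n)
HasCard-⊎ {m = m} {n} A↔ B↔ = ↔-trans (+↔⊎ {m} {n}) (A↔ ⊎-↔ B↔)

HasCard-empty : ∀ {A : Set} → ¬ A → HasCard A 0
HasCard-empty ¬a = mk↔ₛ′ (λ ()) (λ a → contradiction a ¬a) (λ a → contradiction a ¬a) (λ ())

-- Structures on k + 2 vertices with d-sum targetSum k ℓ and dᵢ ≢ 1 for 0 < i < g.
Structures : ℕ → ℕ → ℕ → Set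
Structures k ℓ g = Refinement (Vec ℕ (suc (suc k)) × Vec ℕ (suc (suc k)))
  λ (d , r) → IsStructure d r × sumVec d ≡ targetSum k ℓ × NoOneBefore (g ∸ 1) (tail d)

-- Structures on k + 3 vertices with d-sum targetSum (k + 1) (ℓ + 1) whose first
-- interior vertex with d = 1 is h + 1.
StructuresOneAt : ℕ → ℕ → ℕ → Set
StructuresOneAt k ℓ h = Refinement (Vec ℕ (suc (suc (suc k))) × Vec ℕ (suc (suc (suc k))))
  λ (d , r) → IsStructure d r × sumVec d ≡ targetSum (suc k) (suc ℓ) × NoOneBefore h (tail d) × entry (suc h) d ≡ 1

noOneBefore-smoothD-tail : ∀ {k} h (d : Vec ℕ (suc (suc (suc k)))) →
  NoOneBefore h (tail d) → NoOneBefore (h ∸ 1) (tail (smoothD h d))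
noOneBefore-smoothD-tail zero    d       _   = tt
noOneBefore-smoothD-tail (suc h) (a ∷ v) no1 = noOneBefore-smoothD h v no1

noOneBefore-subdivideD-tail : ∀ {k} h (d : Vec ℕ (suc (suc k))) →
  NoOneBefore (h ∸ 1) (tail d) → Positive d → NoOneBefore h (tail (subdivideD h d))
noOneBefore-subdivideD-tail zero    d       _   _         = tt
noOneBefore-subdivideD-tail (suc h) (a ∷ v) no1 (_ ∷ v>0) = noOneBefore-subdivideD h v no1 v>0

smoothing-↔ : ∀ k ℓ h → h ≤ k → StructuresOneAt k ℓ h ↔ Structures k ℓ h
smoothing-↔ k ℓ h h≤k = mk↔ₛ′ smooth subdivide smooth∘subdivide subdivide∘smooth
  where
    smooth : StructuresOneAt k ℓ h → Structures k ℓ h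
    smooth = Refinement.map (λ (d , r) → smoothD h d , smoothR h r)
      λ { {d , r} (s , sum≡ , no1 , d₁≡1) →
          structure-smooth h d r h≤k s d₁≡1 ,
          +-cancelˡ-≡ 3 _ _ (trans (sum-smoothD h d h≤k (structure-positive d r s) d₁≡1)
                                   (trans sum≡ (targetSum-suc k ℓ))) ,
          noOneBefore-smoothD-tail h d no1 }

    subdivide : Structures k ℓ h → StructuresOneAt k ℓ h
    subdivide = Refinement.map (λ (d , r) → subdivideD h d , subdivideR h r)
      λ { {d , r} (s , sum≡ , no1) →
          structure-subdivide h d r h≤k s ,
          trans (sum-subdivideD h d h≤k) (trans (cong (_+_ 3) sum≡) (sym (targetSum-suc k ℓ))) ,
          noOneBefore-subdivideD-tail h d no1 (structure-positive d r s) ,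
          entry-subdivideD h d h≤k }

    smooth∘subdivide : ∀ x → smooth (subdivide x) ≡ x
    smooth∘subdivide ((d , r) , _) = value-injective (cong₂ _,_ (smooth-subdivideD h d h≤k) (smooth-subdivideR h r h≤k))

    subdivide∘smooth : ∀ x → subdivide (smooth x) ≡ x
    subdivide∘smooth ((d , r) , [ p ]) = value-injective (cong₂ _,_
        (subdivide-smoothD h d h≤k (structure-positive d r s) d₁≡1)
        (subdivide-smoothR h 0 d r h≤k (proj₁ s) d₁≡1))
      where
        s : IsStructure d r
        s = recompute (isStructure? d r) (proj₁ p)
        d₁≡1 : entry (suc h) d ≡ 1
        d₁≡1 = recompute (entry (suc h) d ≟ 1) (proj₂ (proj₂ (proj₂ p)))

firstOne-↔ : ∀ k ℓ h → Structures (suc k) (suc ℓ) (suc h) ↔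
  (Structures (suc k) (suc ℓ) (suc (suc h)) ⊎ StructuresOneAt k ℓ h)
firstOne-↔ k ℓ h = mk↔ₛ′ split join split∘join join∘split
  where
    split : Structures (suc k) (suc ℓ) (suc h) → Structures (suc k) (suc ℓ) (suc (suc h)) ⊎ StructuresOneAt k ℓ h
    split ((a ∷ v , r) , p) with entry h v ≟ 1
    ... | yes vₕ≡1 = inj₂ ((a ∷ v , r) , Irrelevant.map (λ (s , sum≡ , no1) → s , sum≡ , no1 , vₕ≡1) p)
    ... | no  vₕ≢1 = inj₁ ((a ∷ v , r) ,
      Irrelevant.map (λ (s , sum≡ , no1) → s , sum≡ , noOneBefore-snoc h v no1 vₕ≢1) p)

    join : Structures (suc k) (suc ℓ) (suc (suc h)) ⊎ StructuresOneAt k ℓ h → Structures (suc k) (suc ℓ) (suc h)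
    join (inj₁ ((a ∷ v , r) , p)) =
      (a ∷ v , r) , Irrelevant.map (λ (s , sum≡ , no1) → s , sum≡ , noOneBefore-init h v no1) p
    join (inj₂ ((a ∷ v , r) , p)) = (a ∷ v , r) , Irrelevant.map (λ (s , sum≡ , no1 , _) → s , sum≡ , no1) p

    split∘join : ∀ y → split (join y) ≡ y
    split∘join (inj₁ ((a ∷ v , r) , [ p ])) with entry h v ≟ 1
    ... | yes vₕ≡1 = ⊥-elim-irr (noOneBefore-last h v (proj₂ (proj₂ p)) vₕ≡1)
    ... | no  _    = refl
    split∘join (inj₂ ((a ∷ v , r) , [ p ])) with entry h v ≟ 1
    ... | yes _    = refl
    ... | no  vₕ≢1 = ⊥-elim-irr (vₕ≢1 (proj₂ (proj₂ (proj₂ p))))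

    join∘split : ∀ x → join (split x) ≡ x
    join∘split ((a ∷ v , r) , p) with entry h v ≟ 1
    ... | yes _ = refl
    ... | no  _ = refl

-- If dₖ₊₁ ≢ 1 then no interior vertex has d = 1, and the d-sum would be minimal.
lastOne-forced : ∀ k ℓ (d r : Vec ℕ (suc (suc (suc k)))) → IsStructure d r →
  sumVec d ≡ targetSum (suc k) (suc ℓ) → NoOneBefore k (tail d) → entry (suc k) d ≡ 1
lastOne-forced k ℓ (a ∷ v) r s sum≡ no1 with entry k v ≟ 1
... | yes vₖ≡1 = vₖ≡1
... | no  vₖ≢1 = contradiction
  (trans (sym (structure-without-ones-sum (suc k) (a ∷ v) r s (noOneBefore-snoc k v no1 vₖ≢1))) sum≡)
  (λ eq → 0≢1+n (+-cancelˡ-≡ (suc k + suc k) 0 (suc ℓ) (suc-injective (suc-injective eq))))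

lastOne-↔ : ∀ k ℓ → Structures (suc k) (suc ℓ) (suc k) ↔ StructuresOneAt k ℓ k
lastOne-↔ k ℓ = mk↔ₛ′ addLast dropLast (λ _ → refl) (λ _ → refl)
  where
    addLast : Structures (suc k) (suc ℓ) (suc k) → StructuresOneAt k ℓ k
    addLast = Refinement.map (λ x → x)
      λ { {d , r} (s , sum≡ , no1) → s , sum≡ , no1 , lastOne-forced k ℓ d r s sum≡ no1 }
    dropLast : StructuresOneAt k ℓ k → Structures (suc k) (suc ℓ) (suc k)
    dropLast = Refinement.map (λ x → x) λ (s , sum≡ , no1 , _) → s , sum≡ , no1

Structures-flat-card : ∀ k g → g ≤ k → HasCard (Structures k 0 g) 1
Structures-flat-card k g g≤k =
  mk↔ₛ′ (λ _ → minimal) (λ _ → fzero) minimal-unique (λ { fzero → refl ; (fsuc ()) })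
  where
    minimal : Structures k 0 g
    minimal = (minimalD k , replicate (suc (suc k)) 1) ,
      [ minimal-structure k , sum-minimalD k , noOneBefore-twosThenOne (g ∸ 1) k (≤-trans (m∸n≤m g 1) g≤k) ]
    minimal-unique : ∀ x → minimal ≡ x
    minimal-unique ((d , r) , [ p ])
      with structure-minimal-sum k d r (recompute (isStructure? d r) (proj₁ p))
                                       (recompute (sumVec d ≟ targetSum k 0) (proj₁ (proj₂ p)))
    ... | refl , refl = refl

Structures-zero-width-empty : ∀ ℓ → HasCard (Structures 0 (suc ℓ) 0) 0
Structures-zero-width-empty ℓ = HasCard-empty λ ((d , r) , [ p ]) → ⊥-elim-irr (excess-impossible d r p)
  where
    excess-impossible : ∀ d r → ¬ (IsStructure d r × sumVec d ≡ targetSum 0 (suc ℓ) × NoOneBefore 0 (tail d))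
    excess-impossible d r (s , sum≡ , _) = contradiction (trans (sym (structure-without-ones-sum 0 d r s tt)) sum≡) (λ ())

-- Both sides satisfy the same recursion: a path from (g , 0) first steps east,
-- or north, and a structure has its first interior 1 after vertex g, or at it.
Structures-card : ∀ ℓ k g → g ≤ k → HasCard (Structures k ℓ g) (ballotFrom g k ℓ)
Structures-card zero    k       g    g≤k =
  subst (HasCard _) (sym (ballotFrom-flat k g g≤k)) (Structures-flat-card k g g≤k)
Structures-card (suc ℓ) zero    zero z≤n =
  subst (HasCard _) (sym (ballotFrom-zero-width ℓ)) (Structures-zero-width-empty ℓ)
Structures-card (suc ℓ) (suc k) g    g≤k = descend (suc k ∸ g) g (m∸n+n≡m g≤k)
  where
    oneAt-card : ∀ h → h ≤ k → HasCard (StructuresOneAt k ℓ h) (ballotFrom h k ℓ)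
    oneAt-card h h≤k = ↔-trans (Structures-card ℓ k h h≤k) (↔-sym (smoothing-↔ k ℓ h h≤k))

    descend : ∀ e g → e + g ≡ suc k → HasCard (Structures (suc k) (suc ℓ) g) (ballotFrom g (suc k) (suc ℓ))
    descend zero    g       refl = subst (HasCard _) (sym (ballotFrom-corner k ℓ))
      (↔-trans (oneAt-card k ≤-refl) (↔-sym (lastOne-↔ k ℓ)))
    descend (suc e) zero    eq   = subst (HasCard _) (sym (ballotFrom-origin k ℓ))
      (descend e 1 (trans (+-comm e 1) (trans (cong suc (sym (+-identityʳ e))) eq)))
    descend (suc e) (suc h) eq   = subst (HasCard _) (sym (ballotFrom-split k ℓ h h<k))
      (↔-trans (HasCard-⊎ (descend e (suc (suc h)) (trans (+-suc e (suc h)) eq)) (oneAt-card h (<⇒≤ h<k)))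
               (↔-sym (firstOne-↔ k ℓ h)))
      where
        h<k : h < k
        h<k = s≤s⁻¹ (subst (suc h <_) eq (m<n+m (suc h) (s≤s (z≤n {e}))))

-- The matrix formulation

diagonalEntry : ℕ → ℕ → ℤ → ℤ
diagonalEntry zero    zero    v = v
diagonalEntry (suc a) (suc b) v = diagonalEntry a b v
diagonalEntry zero    (suc b) v = + 0
diagonalEntry (suc a) zero    v = + 0

adjacencyEntry : ℕ → ℕ → ℤ
adjacencyEntry (suc a)       (suc b)       = adjacencyEntry a b
adjacencyEntry zero          (suc zero)    = + 1
adjacencyEntry (suc zero)    zero          = + 1
adjacencyEntry zero          zero          = + 0
adjacencyEntry zero          (suc (suc b)) = + 0
adjacencyEntry (suc (suc a)) zero          = + 0

diagonalEntry-≡ : ∀ a v → diagonalEntry a a v ≡ v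
diagonalEntry-≡ zero    v = refl
diagonalEntry-≡ (suc a) v = diagonalEntry-≡ a v

diagonalEntry-≢ : ∀ a b v → a ≢ b → diagonalEntry a b v ≡ + 0
diagonalEntry-≢ zero    zero    v a≢b = contradiction refl a≢b
diagonalEntry-≢ zero    (suc b) v _   = refl
diagonalEntry-≢ (suc a) zero    v _   = refl
diagonalEntry-≢ (suc a) (suc b) v a≢b = diagonalEntry-≢ a b v (λ a≡b → a≢b (cong suc a≡b))

adjacencyEntry-right : ∀ a → adjacencyEntry a (suc a) ≡ + 1
adjacencyEntry-right zero    = refl
adjacencyEntry-right (suc a) = adjacencyEntry-right a

adjacencyEntry-left : ∀ b → adjacencyEntry (suc b) b ≡ + 1
adjacencyEntry-left zero    = refl
adjacencyEntry-left (suc b) = adjacencyEntry-left b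

adjacencyEntry-far : ∀ a b → b ≢ suc a → a ≢ suc b → adjacencyEntry a b ≡ + 0
adjacencyEntry-far zero          zero          _ _ = refl
adjacencyEntry-far zero          (suc zero)    b≢ _ = contradiction refl b≢
adjacencyEntry-far zero          (suc (suc b)) _ _ = refl
adjacencyEntry-far (suc zero)    zero          _ a≢ = contradiction refl a≢
adjacencyEntry-far (suc (suc a)) zero          _ _ = refl
adjacencyEntry-far (suc a)       (suc b)       b≢ a≢ =
  adjacencyEntry-far a b (λ e → b≢ (cong suc e)) (λ e → a≢ (cong suc e))

diagM-entry : ∀ {n} (d : Vec ℕ n) i j → diagM d i j ≡ diagonalEntry (toℕ i) (toℕ j) (+ lookup d i)
diagM-entry d i j with toℕ i ≟ toℕ j
... | yes i≡j rewrite i≡j = sym (diagonalEntry-≡ (toℕ j) _)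
... | no  i≢j = sym (diagonalEntry-≢ _ _ _ i≢j)

pathAdj-entry : ∀ {n} (i j : Fin n) → pathAdj i j ≡ adjacencyEntry (toℕ i) (toℕ j)
pathAdj-entry i j with toℕ j ≟ suc (toℕ i) | toℕ i ≟ suc (toℕ j)
... | yes j≡i+1 | _        rewrite j≡i+1 = sym (adjacencyEntry-right (toℕ i))
... | no  _     | yes i≡j+1 rewrite i≡j+1 = sym (adjacencyEntry-left (toℕ j))
... | no  j≢i+1 | no i≢j+1 = sym (adjacencyEntry-far _ _ j≢i+1 i≢j+1)

sumFin-cong : ∀ {n} {f g : Fin n → ℤ} → (∀ j → f j ≡ g j) → sumFin f ≡ sumFin g
sumFin-cong {zero}  f≗g = refl
sumFin-cong {suc n} f≗g = cong₂ ℤ._+_ (f≗g fzero) (sumFin-cong (λ j → f≗g (fsuc j)))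

sumFin-zero : ∀ n → sumFin {n} (λ _ → + 0) ≡ + 0
sumFin-zero zero    = refl
sumFin-zero (suc n) = trans (ℤₚ.+-identityˡ _) (sumFin-zero n)

-- rₐ₋₁, where r₋₁ = p.
previousEntry : ∀ {n} → ℕ → ℕ → Vec ℕ n → ℕ
previousEntry p zero    _ = p
previousEntry p (suc a) r = entry a r

laplacianEntry : ℕ → ℕ → ℤ → ℤ
laplacianEntry a b D = diagonalEntry a b D ℤ.- adjacencyEntry a b

laplacian-row₀-tail : ∀ {n} (r : Vec ℕ n) →
  sumFin (λ j → laplacianEntry 0 (suc (toℕ j)) (+ 0) ℤ.* + lookup r j) ≡ ℤ.- (+ entry 0 r)
laplacian-row₀-tail []           = refl
laplacian-row₀-tail {suc n} (y ∷ r) =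
  trans (cong (ℤ._+_ (ℤ.-[1+ 0 ] ℤ.* + y)) (trans (sumFin-cong {n} (λ _ → refl)) (sumFin-zero n))) (shuffle (+ y))
  where
    shuffle : ∀ y → ℤ.-[1+ 0 ] ℤ.* y ℤ.+ + 0 ≡ ℤ.- y
    shuffle = ℤ-Solver.solve-∀

laplacian-row : ∀ {n} a D (r : Vec ℕ n) → sumFin (λ j → laplacianEntry a (toℕ j) D ℤ.* + lookup r j)
  ≡ D ℤ.* + entry a r ℤ.- (+ previousEntry 0 a r ℤ.+ + entry (suc a) r)
laplacian-row zero          D []      = shuffle D
  where
    shuffle : ∀ D → + 0 ≡ D ℤ.* + 0 ℤ.- (+ 0 ℤ.+ + 0)
    shuffle = ℤ-Solver.solve-∀
laplacian-row (suc a)       D []      = shuffle D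
  where
    shuffle : ∀ D → + 0 ≡ D ℤ.* + 0 ℤ.- (+ 0 ℤ.+ + 0)
    shuffle = ℤ-Solver.solve-∀
laplacian-row zero          D (x ∷ r) =
  trans (cong (ℤ._+_ ((D ℤ.- + 0) ℤ.* + x)) (laplacian-row₀-tail r)) (shuffle D (+ x) (+ entry 0 r))
  where
    shuffle : ∀ D X Y → (D ℤ.- + 0) ℤ.* X ℤ.+ ℤ.- Y ≡ D ℤ.* X ℤ.- (+ 0 ℤ.+ Y)
    shuffle = ℤ-Solver.solve-∀
laplacian-row (suc zero)    D (x ∷ r) =
  trans (cong (ℤ._+_ (ℤ.-[1+ 0 ] ℤ.* + x)) (laplacian-row zero D r)) (shuffle D (+ x) (+ entry 0 r) (+ entry 1 r))
  where
    shuffle : ∀ D X A B → ℤ.-[1+ 0 ] ℤ.* X ℤ.+ (D ℤ.* A ℤ.- (+ 0 ℤ.+ B)) ≡ D ℤ.* A ℤ.- (X ℤ.+ B)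
    shuffle = ℤ-Solver.solve-∀
laplacian-row (suc (suc a)) D (x ∷ r) =
  trans (cong (ℤ._+_ (+ 0 ℤ.* + x)) (laplacian-row (suc a) D r))
        (shuffle D (+ x) (+ entry (suc a) r) (+ entry a r) (+ entry (suc (suc a)) r))
  where
    shuffle : ∀ D X A C B → + 0 ℤ.* X ℤ.+ (D ℤ.* A ℤ.- (C ℤ.+ B)) ≡ D ℤ.* A ℤ.- (C ℤ.+ B)
    shuffle = ℤ-Solver.solve-∀

entry-lookup : ∀ {n} (r : Vec ℕ n) i → entry (toℕ i) r ≡ lookup r i
entry-lookup (x ∷ r) fzero    = refl
entry-lookup (x ∷ r) (fsuc i) = entry-lookup r i

mulMV-lapM : ∀ {n} (d r : Vec ℕ n) i →
  mulMV (lapM d) r i ≡ + (lookup d i * lookup r i) ℤ.- + (previousEntry 0 (toℕ i) r + entry (suc (toℕ i)) r)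
mulMV-lapM d r i = begin
    sumFin (λ j → lapM d i j ℤ.* + lookup r j)
  ≡⟨ sumFin-cong (λ j → cong (ℤ._* + lookup r j) (cong₂ ℤ._-_ (diagM-entry d i j) (pathAdj-entry i j))) ⟩
    sumFin (λ j → laplacianEntry (toℕ i) (toℕ j) (+ lookup d i) ℤ.* + lookup r j)
  ≡⟨ laplacian-row (toℕ i) (+ lookup d i) r ⟩
    + lookup d i ℤ.* + entry (toℕ i) r ℤ.- (+ previousEntry 0 (toℕ i) r ℤ.+ + entry (suc (toℕ i)) r)
  ≡⟨ cong₂ ℤ._-_ (trans (cong (λ t → + lookup d i ℤ.* + t) (entry-lookup r i)) (sym (ℤₚ.pos-* (lookup d i) (lookup r i))))
                 (sym (ℤₚ.pos-+ (previousEntry 0 (toℕ i) r) (entry (suc (toℕ i)) r))) ⟩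
    + (lookup d i * lookup r i) ℤ.- + (previousEntry 0 (toℕ i) r + entry (suc (toℕ i)) r)
  ∎
  where open ≡-Reasoning

Pointwise : ∀ {n} → ℕ → Vec ℕ n → Vec ℕ n → Set
Pointwise p d r = ∀ i → lookup d i * lookup r i ≡ previousEntry p (toℕ i) r + entry (suc (toℕ i)) r

previousEntry-∷ : ∀ {n} p a x (r : Vec ℕ n) → previousEntry p (suc a) (x ∷ r) ≡ previousEntry x a r
previousEntry-∷ p zero    x r = refl
previousEntry-∷ p (suc a) x r = refl

recurrence⇒pointwise : ∀ {n} p (d r : Vec ℕ n) → Recurrence p d r → Pointwise p d r
recurrence⇒pointwise p (a ∷ d) (x ∷ r) (e , rec) fzero    = e
recurrence⇒pointwise p (a ∷ d) (x ∷ r) (e , rec) (fsuc i) =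
  trans (recurrence⇒pointwise x d r rec i) (cong (_+ entry (suc (toℕ i)) r) (sym (previousEntry-∷ p (toℕ i) x r)))

pointwise⇒recurrence : ∀ {n} p (d r : Vec ℕ n) → Pointwise p d r → Recurrence p d r
pointwise⇒recurrence p []      []      _  = tt
pointwise⇒recurrence p (a ∷ d) (x ∷ r) eq = eq fzero ,
  pointwise⇒recurrence x d r λ i →
    trans (eq (fsuc i)) (cong (_+ entry (suc (toℕ i)) r) (previousEntry-∷ p (toℕ i) x r))

-- m divides r₋₁ = p and r₀, so by the recurrence it divides every rᵢ.
∣-gcdVec : ∀ {n} m p (d r : Vec ℕ n) → Recurrence p d r → m ∣ p → m ∣ entry 0 r → m ∣ gcdVec r
∣-gcdVec m p []      []      _         _   _   = m ∣0
∣-gcdVec m p (a ∷ d) (x ∷ r) (e , rec) m∣p m∣x = gcd-greatest m∣x (∣-gcdVec m x d r rec m∣x m∣next)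
  where
    m∣next : m ∣ entry 0 r
    m∣next = ∣m+n∣m⇒∣n (subst (m ∣_) e (subst (m ∣_) (*-comm x a) (∣m⇒∣m*n a m∣x))) m∣p

gcdVec≡1⇒entry₀≡1 : ∀ {n} (d r : Vec ℕ n) → Recurrence 0 d r → gcdVec r ≡ 1 → entry 0 r ≡ 1
gcdVec≡1⇒entry₀≡1 d r rec gcd≡1 =
  ∣1⇒≡1 (subst (entry 0 r ∣_) gcd≡1 (∣-gcdVec (entry 0 r) 0 d r rec (entry 0 r ∣0) ∣-refl))

entry₀≡1⇒gcdVec≡1 : ∀ {n} (r : Vec ℕ (suc n)) → entry 0 r ≡ 1 → gcdVec r ≡ 1
entry₀≡1⇒gcdVec≡1 (x ∷ r) refl = ∣1⇒≡1 (gcd[m,n]∣m 1 (gcdVec r))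

arith⇒structure : ∀ {n} (d r : Vec ℕ n) → IsArith n d r → IsStructure d r
arith⇒structure d r (_ , r>0 , gcd≡1 , kernel) = rec , lookup⁻ r>0 , gcdVec≡1⇒entry₀≡1 d r rec gcd≡1
  where
    rec : Recurrence 0 d r
    rec = pointwise⇒recurrence 0 d r λ i →
      ℤₚ.+-injective (ℤₚ.i-j≡0⇒i≡j _ _ (trans (sym (mulMV-lapM d r i)) (kernel i)))

structure⇒arith : ∀ {n} (d r : Vec ℕ (suc (suc n))) → IsStructure d r → IsArith (suc (suc n)) d r
structure⇒arith d r s@(rec , r>0 , r₀≡1) =
  lookup⁺ (structure-positive d r s) , lookup⁺ r>0 , entry₀≡1⇒gcdVec≡1 r r₀≡1 ,
  λ i → trans (mulMV-lapM d r i) (ℤₚ.i≡j⇒i-j≡0 (cong +_ (recurrence⇒pointwise 0 d r rec i)))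

Structures↔ArithSum : ∀ m ℓ → Structures m ℓ 0 ↔ ArithSum (suc (suc m)) (+ targetSum m ℓ)
Structures↔ArithSum m ℓ = mk↔ₛ′ toArith fromArith (λ _ → refl) (λ _ → refl)
  where
    toArith : Structures m ℓ 0 → ArithSum (suc (suc m)) (+ targetSum m ℓ)
    toArith = Refinement.map (λ x → x) λ { {d , r} (s , sum≡ , _) → structure⇒arith d r s , cong +_ sum≡ }
    fromArith : ArithSum (suc (suc m)) (+ targetSum m ℓ) → Structures m ℓ 0
    fromArith = Refinement.map (λ x → x)
      λ { {d , r} (a , sum≡) → arith⇒structure d r a , ℤₚ.+-injective sum≡ , tt }

ArithSum-excess-card : ∀ m ℓ → HasCard (ArithSum (suc (suc m)) (+ targetSum m ℓ)) (ballot m (+ ℓ))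
ArithSum-excess-card m ℓ = ↔-trans (Structures-card ℓ m 0 z≤n) (Structures↔ArithSum m ℓ)

ArithSum-excess : ∀ m {k} → ArithSum (suc (suc m)) k → Σ[ ℓ ∈ ℕ ] k ≡ + targetSum m ℓ
ArithSum-excess m {k} ((d , r) , [ p ]) =
  sumVec d ∸ targetSum m 0 ,
  trans (sym sum≡) (cong +_ (trans (sym (m+[n∸m]≡n sum≥)) (targetSum-excess m _)))
  where
    sum≡ : + sumVec d ≡ k
    sum≡ = recompute (+ sumVec d ℤₚ.≟ k) (proj₂ p)
    sum≥ : targetSum m 0 ≤ sumVec d
    sum≥ = recompute (targetSum m 0 ≤? sumVec d) (structure-sum-≥ m d r (arith⇒structure d r (proj₁ p)))

ArithSum-excess-≤ : ∀ m ℓ → ArithSum (suc (suc m)) (+ targetSum m ℓ) → ℓ ≤ m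
ArithSum-excess-≤ m ℓ x with ℓ ≤? m
... | yes ℓ≤m = ℓ≤m
... | no  ℓ≰m =
  contradiction (subst Fin (ballot-above-diagonal m ℓ (≰⇒> ℓ≰m)) (Inverse.from (ArithSum-excess-card m ℓ) x)) ¬Fin0

ArithSum-sum-≥ : ∀ m {k} → ArithSum (suc (suc m)) k → + targetSum m 0 ℤ.≤ k
ArithSum-sum-≥ m x with ArithSum-excess m x
... | ℓ , refl = ℤ.+≤+ (targetSum-monoʳ m z≤n)

ArithSum-sum-≤ : ∀ m {k} → ArithSum (suc (suc m)) k → k ℤ.≤ + targetSum m m
ArithSum-sum-≤ m x with ArithSum-excess m x
... | ℓ , refl = ℤ.+≤+ (targetSum-monoʳ m (ArithSum-excess-≤ m ℓ x))

+[m+n]-+m≡+n : ∀ m n → + (m + n) ℤ.- + m ≡ + n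
+[m+n]-+m≡+n m n = trans (cong (λ i → i ℤ.- + m) (ℤₚ.pos-+ m n)) (cancel (+ m) (+ n))
  where
    cancel : ∀ M N → M ℤ.+ N ℤ.- M ≡ N
    cancel = ℤ-Solver.solve-∀

i-+m≡+n⇒i≡+[m+n] : ∀ {i} m n → i ℤ.- + m ≡ + n → i ≡ + (m + n)
i-+m≡+n⇒i≡+[m+n] {i} m n i-m≡n = begin
    i                      ≡⟨ split i (+ m) ⟩
    i ℤ.- + m ℤ.+ + m      ≡⟨ cong (ℤ._+ + m) i-m≡n ⟩
    + n ℤ.+ + m            ≡⟨ sym (ℤₚ.pos-+ n m) ⟩
    + (n + m)              ≡⟨ cong +_ (+-comm n m) ⟩
    + (m + n)              ∎
  where
    open ≡-Reasoning
    split : ∀ I M → I ≡ I ℤ.- M ℤ.+ M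
    split = ℤ-Solver.solve-∀

ArithSum-card : ∀ m k → HasCard (ArithSum (suc (suc m)) k) (ballot m (k ℤ.- + targetSum m 0))
ArithSum-card m k with k ℤ.- + targetSum m 0 in excess≡
... | + ℓ = subst (λ k → HasCard (ArithSum (suc (suc m)) k) (ballot m (+ ℓ)))
                  (sym (trans (i-+m≡+n⇒i≡+[m+n] (targetSum m 0) ℓ excess≡) (cong +_ (targetSum-excess m ℓ))))
                  (ArithSum-excess-card m ℓ)
... | ℤ.-[1+ j ] = HasCard-empty λ x → let (ℓ , k≡) = ArithSum-excess m x in
  contradiction (begin
    ℤ.-[1+ j ]                                  ≡⟨ sym excess≡ ⟩
    k ℤ.- + targetSum m 0                       ≡⟨ cong (λ i → i ℤ.- + targetSum m 0) k≡ ⟩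
    + targetSum m ℓ ℤ.- + targetSum m 0         ≡⟨ cong (λ t → + t ℤ.- + targetSum m 0) (sym (targetSum-excess m ℓ)) ⟩
    + (targetSum m 0 + ℓ) ℤ.- + targetSum m 0   ≡⟨ +[m+n]-+m≡+n (targetSum m 0) ℓ ⟩
    + ℓ                                         ∎) (λ ())
  where open ≡-Reasoning

corollary2p10 : (n : ℕ) → 2 ≤ n → (k : ℤ) →
    HasCard (ArithSum n k) (ballot (n ∸ 2) (k ℤ.- + (2 * n ∸ 2))) ×
    (ArithSum n k → (+ (2 * n ∸ 2) ℤ.≤ k) × (k ℤ.≤ + (3 * n ∸ 4)))
corollary2p10 (suc (suc m)) (s≤s (s≤s z≤n)) k =
  subst (λ c → HasCard (ArithSum (suc (suc m)) k) (ballot m (k ℤ.- + c))) (sym lowest) (ArithSum-card m k) ,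
  λ x → subst (λ c → + c ℤ.≤ k) (sym lowest) (ArithSum-sum-≥ m x) ,
        subst (λ c → k ℤ.≤ + c) (sym highest) (ArithSum-sum-≤ m x)
  where
    lowest : 2 * suc (suc m) ∸ 2 ≡ targetSum m 0
    lowest = cong (_∸ 2) (expand m)
      where
        expand : ∀ m → 2 * suc (suc m) ≡ 2 + suc (suc (m + m + 0))
        expand = solve-∀
    highest : 3 * suc (suc m) ∸ 4 ≡ targetSum m m
    highest = cong (_∸ 4) (expand m)
      where
        expand : ∀ m → 3 * suc (suc m) ≡ 4 + suc (suc (m + m + m))
        expand = solve-∀
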